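{- Let $(G,\tau)$ be a signed graph, let $e=uv$ be an edge, and let $\mathbf{w}_1$ and $\mathbf{w}_2$ be two even closed walks both starting with the terms $u,e,v$; write $\mathbf{w}_i=uev+\mathbf{w}'_i$ for $i=1,2$, where $\mathbf{w}'_i$ is a $(v,u)$-walk, and let $\mathbf{w}'=\mathbf{w}'_1+(\mathbf{w}'_2)^{ -1}$. Then $B_{\mathbf{w}'}\in\langle B_{\mathbf{w}_1},B_{\mathbf{w}_2}\rangle$.
   Context: Graphs are finite and simple; a sign $\tau$ of $G$ assigns $1$ or $-1$ to each pair $(e,v)$ with $v$ an endpoint of edge $e$. A walk $v_1e_1v_2\cdots e_tv_{t+1}$ has $e_i=v_iv_{i+1}$; closed if $v_{t+1}=v_1$. $\mathbf{w}+\mathbf{w}'$ is concatenation and $\mathbf{w}^{ -1}$ the reversed walk. For a closed walk $v_1e_1\cdots e_tv_1$ ($t\ge2$), a vertex term $v_i$ is unbalanced if $\tau(e_{i-1},v_i)\tau(e_i,v_i)=1$ (indices cyclic); the walk is even if it has an even number of unbalanced vertex terms. A balanced section of a closed walk is a maximal section (consecutive terms, cyclically) with no internal unbalanced vertex term. An even closed walk $\mathbf{x}$ with an unbalanced vertex term, started at one, decomposes uniquely into consecutive balanced sections $\mathbf{x}_0,\dots,\mathbf{x}_{2k-1}$, and $B_{\mathbf{x}}=\prod_{i\text{ even}}\prod_{e\in E(\mathbf{x}_i)}e-\prod_{i\text{ odd}}\prod_{e\in E(\mathbf{x}_i)}e$ (edges with multiplicity, as variables of a polynomial ring over a field); if $\mathbf{x}$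 has no unbalanced vertex term, $B_{\mathbf{x}}=\prod_{e\in E(\mathbf{x})}e-1$. $B_{\mathbf{x}}$ is determined up to sign. (Under the hypotheses, $\mathbf{w}'$ is an even closed walk.) -}

module Defs where

open import Level using (Level; _⊔_; suc)
open import Algebra.Bundles using (CommutativeRing)
open import Data.Nat using (ℕ; zero)
import Data.Nat as ℕ
open import Data.Nat.Properties using () renaming (_≟_ to _≟ℕ_)
open import Data.Fin using (Fin)
open import Data.Bool using (Bool; true; false; _xor_; not)
open import Data.Sign using (Sign) renaming (_*_ to _*ₛ_)
open import Data.List using (List; []; _∷_; _++_; length; filter)
open import Data.Vec using (Vec; replicate; updateAt; zipWith)
open import Data.Vec.Properties using (≡-dec)
open import Data.Product using (proj₁; proj₂; _×_; _,_; Σ; ∃; ∃-syntax)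
open import Data.Sum using (_⊎_)
open import Relation.Nullary using (¬_; yes; no)
open import Relation.Binary.PropositionalEquality using (_≡_; _≢_)

record Field (c ℓ : Level) : Set (suc (c ⊔ ℓ)) where
  field
    commutativeRing : CommutativeRing c ℓ
  open CommutativeRing commutativeRing public
  field
    1≉0     : ¬ (1# ≈ 0#)
    inverse : ∀ x → ¬ (x ≈ 0#) → Σ Carrier (λ y → (x * y) ≈ 1#)

-- The sign τ f x is only meaningful when x is an endpoint of f.

SameEnds : ∀ {n m} → (Fin m → Fin n) → (Fin m → Fin n) → Fin m → Fin m → Set
SameEnds end₁ end₂ f g =
  (end₁ f ≡ end₁ g × end₂ f ≡ end₂ g) ⊎ (end₁ f ≡ end₂ g × end₂ f ≡ end₁ g)

record SignedGraph : Set where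
  field
    n m    : ℕ
    end₁   : Fin m → Fin n
    end₂   : Fin m → Fin n
    noLoop : ∀ f → end₁ f ≢ end₂ f
    simple : ∀ f g → SameEnds end₁ end₂ f g → f ≡ g
    τ      : Fin m → Fin n → Sign

module _ (G : SignedGraph) where
  open SignedGraph G

  Joins : Fin m → Fin n → Fin n → Set
  Joins f a b = (end₁ f ≡ a × end₂ f ≡ b) ⊎ (end₁ f ≡ b × end₂ f ≡ a)

  data Walk : Fin n → Fin n → Set where
    []   : ∀ {a} → Walk a a
    step : ∀ {a b c} (f : Fin m) → Joins f a b → Walk b c → Walk a c

infixr 5 _⟨_⟩∷_
_⟨_⟩∷_ : ∀ {G} {a b c} (f : Fin (SignedGraph.m G)) → Joins G f a b → Walk G b c → Walk G a c
f ⟨ j ⟩∷ w = step f j w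

module _ {G : SignedGraph} where
  open SignedGraph G
  open import Data.Sum using (inj₁; inj₂)
  open import Relation.Binary.PropositionalEquality using (sym)

  joins-sym : ∀ {f a b} → Joins G f a b → Joins G f b a
  joins-sym (inj₁ (p , q)) = inj₂ (p , q)
  joins-sym (inj₂ (p , q)) = inj₁ (p , q)

  infixr 5 _++ʷ_
  _++ʷ_ : ∀ {a b c} → Walk G a b → Walk G b c → Walk G a c
  []           ++ʷ w' = w'
  step f j w   ++ʷ w' = step f j (w ++ʷ w')

  reverseʷ : ∀ {a b} → Walk G a b → Walk G b a
  reverseʷ []           = []
  reverseʷ (step f j w) = reverseʷ w ++ʷ step f (joins-sym j) []

  edges : ∀ {a b} → Walk G a b → List (Fin m)
  edges []           = []
  edges (step f _ w) = f ∷ edges w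

  halfSigns : ∀ {a b} → Walk G a b → List (Sign × Sign)
  halfSigns {a} (step {b = b} f _ w) = (τ f a , τ f b) ∷ halfSigns w
  halfSigns []                       = []

-- Unbalanced vertex terms of a closed walk  v₁ e₁ v₂ ⋯ eₜ v₁.
-- Vertex term vᵢ is unbalanced iff τ(eᵢ₋₁,vᵢ) τ(eᵢ,vᵢ) = 1 (cyclic).

isPlus : Sign → Bool
isPlus Sign.+ = true
isPlus Sign.- = false

-- flags for the vertex terms v₂ … vₜ given the consecutive half-sign pairs
innerFlags : List (Sign × Sign) → List Bool
innerFlags []                                   = []
innerFlags (_ ∷ [])                             = []
innerFlags ((_ , b) ∷ ((a' , b') ∷ rest)) =
  isPlus (b *ₛ a') ∷ innerFlags ((a' , b') ∷ rest)

lastSnd : Sign → List (Sign × Sign) → Sign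
lastSnd s []             = s
lastSnd _ ((_ , b) ∷ xs) = lastSnd b xs

-- flags for the vertex terms v₁ , v₂ , … , vₜ
vertexFlags : List (Sign × Sign) → List Bool
vertexFlags []               = []
vertexFlags ((a , b) ∷ rest) =
  isPlus (lastSnd b rest *ₛ a) ∷ innerFlags ((a , b) ∷ rest)

module _ {G : SignedGraph} where
  open SignedGraph G

  unbalancedFlags : ∀ {a} → Walk G a a → List Bool
  unbalancedFlags w = vertexFlags (halfSigns w)

  numUnbalanced : ∀ {a} → Walk G a a → ℕ
  numUnbalanced w = length (filter (λ b → b Data.Bool.≟ true) (unbalancedFlags w))
    where import Data.Bool

  EvenWalk : ∀ {a} → Walk G a a → Set
  EvenWalk w = Σ ℕ (λ k → numUnbalanced w ≡ 2 ℕ.* k)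

-- The polynomial ring K[xₑ : e ∈ E(G)], constructed concretely:
-- a polynomial is a finite formal sum of terms c·x^α (α ∈ ℕ^m);
-- two polynomials are equal iff all their coefficients agree.

module Poly {c ℓ} (K : Field c ℓ) (m : ℕ) where
  open Field K

  Monomial : Set
  Monomial = Vec ℕ m

  Polynomial : Set c
  Polynomial = List (Carrier × Monomial)

  coeff : Polynomial → Monomial → Carrier
  coeff []             μ = 0#
  coeff ((a , α) ∷ p)  μ with ≡-dec _≟ℕ_ α μ
  ... | yes _ = a + coeff p μ
  ... | no  _ = coeff p μ

  infix 4 _≈ₚ_
  _≈ₚ_ : Polynomial → Polynomial → Set ℓ
  p ≈ₚ q = ∀ μ → coeff p μ ≈ coeff q μ

  infixl 6 _+ₚ_
  _+ₚ_ : Polynomial → Polynomial → Polynomial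
  p +ₚ q = p ++ q

  -ₚ_ : Polynomial → Polynomial
  -ₚ_ = Data.List.map (λ { (a , α) → (- a , α) })

  infixl 7 _*ₚ_
  _*ₚ_ : Polynomial → Polynomial → Polynomial
  []            *ₚ q = []
  ((a , α) ∷ p) *ₚ q =
    Data.List.map (λ { (b , β) → (a * b , zipWith ℕ._+_ α β) }) q ++ (p *ₚ q)

  monomialOf : List (Fin m) → Monomial
  monomialOf []       = replicate m 0
  monomialOf (e ∷ es) = updateAt (monomialOf es) e ℕ.suc

  binomial : List (Fin m) → List (Fin m) → Polynomial
  binomial es fs = (1# , monomialOf es) ∷ (- 1# , monomialOf fs) ∷ []

  InIdeal₂ : Polynomial → Polynomial → Polynomial → Set (c ⊔ ℓ)
  InIdeal₂ p q₁ q₂ = Σ Polynomial (λ f → Σ Polynomial (λ g → p ≈ₚ f *ₚ q₁ +ₚ g *ₚ q₂))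

-- Edge e₁ gets parity false; edge eᵢ₊₁ gets the parity of eᵢ flipped iff
-- the vertex term vᵢ₊₁ is unbalanced.  For an even closed walk the
-- maximal runs of equal parity are exactly the balanced sections (the one
-- through v₁ wrapping around when v₁ is balanced), alternately even/odd,
-- so  B_x = ∏_{parity false} e − ∏_{parity true} e  (up to sign); with no
-- unbalanced vertex term this is ∏_{e} e − 1.

nextParity : Bool → List Bool → Bool
nextParity p []      = p
nextParity p (b ∷ _) = p xor b

dropFlag : List Bool → List Bool
dropFlag []       = []
dropFlag (_ ∷ bs) = bs

place : ∀ {A : Set} → Bool → A → List A × List A → List A × List A
place false x (ev , od) = x ∷ ev , od
place true  x (ev , od) = ev , x ∷ od

splitParity : ∀ {A : Set} → Bool → List A → List Bool → List A × List A
splitParity p []       _  = [] , []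
splitParity p (x ∷ xs) fs = place p x (splitParity (nextParity p fs) xs (dropFlag fs))

module _ {c ℓ} (K : Field c ℓ) {G : SignedGraph} where
  open SignedGraph G
  open Poly K m

  -- flags of vertex terms v₂ … vₜ (the flag of v₁ is not needed)
  B : ∀ {a} → Walk G a a → Polynomial
  B w = binomial (proj₁ parts) (proj₂ parts)
    where parts = splitParity false (edges w) (innerFlags (halfSigns w))

{-# OPTIONS --safe #-}
-- Give the edge eᵢ of a walk v₁e₁v₂⋯ the label cᵢτ(eᵢ,vᵢ), where cᵢ₊₁ = cᵢσ(eᵢ) and
-- σ(eᵢ) = −τ(eᵢ,vᵢ)τ(eᵢ,vᵢ₊₁).  The label flips exactly at the unbalanced vertex terms, so the
-- edges labelled + and − form the even and odd balanced sections, and a closed walk is even iff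
-- ∏σ(eᵢ) = +.  Appending a walk multiplies its labels by the sign ∏σ of what precedes it, and a
-- reversed walk started from c carries the labels of the forward walk started from −c∏σ(eᵢ).
-- Since w₁ and w₂ are even, w′₁ and w′₂ have the same sign; writing U₊, U₋ and W₊, W₋ for the
-- products over the edges of w′₁ and w′₂ of each label in w₁ and w₂, this gives
-- B_{w₁} = e U₊ − U₋, B_{w₂} = e W₊ − W₋ and B_{w′} = ±(U₊W₋ − U₋W₊) = ±(W₊B_{w₁} − U₊B_{w₂}).

module Submission where

open import Defs
open import Data.Bool using (Bool; true; false; _xor_)
import Data.Bool as Bool
open import Data.Empty using (⊥-elim)
open import Data.Fin using (Fin; zero; suc)
open import Data.List using (List; []; _∷_; _++_; length; filter)
open import Data.Nat using (ℕ)
import Data.Nat as ℕ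
import Data.Nat.Properties as ℕₚ
open import Data.Nat.Properties using () renaming (_≟_ to _≟ℕ_)
open import Data.Product using (_×_; _,_)
import Data.Product as Product
open import Data.Sign as Sign using (Sign; opposite) renaming (_*_ to _*ₛ_)
open import Data.Sign.Properties using (s*s≡+; *-commutativeMonoid)
  renaming ( *-identityʳ to *ₛ-identityʳ; *-assoc to *ₛ-assoc; *-comm to *ₛ-comm
           ; *-cancelˡ-≡ to *ₛ-cancelˡ-≡)
open import Data.Sum using (inj₁; inj₂)
open import Data.Vec using (Vec; _∷_; replicate; updateAt; zipWith)
open import Data.Vec.Properties using (≡-dec; zipWith-comm; zipWith-identityˡ)
open import Relation.Binary.PropositionalEquality
  using (_≡_; refl; sym; trans; cong; cong₂; subst; module ≡-Reasoning)
open import Relation.Nullary using (¬_; yes; no)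
open import Algebra.Solver.CommutativeMonoid *-commutativeMonoid using (solve; _⊜_)
  renaming (_⊕_ to _·_)

-- Signs

x*[y*y]≡x : ∀ x y → x *ₛ (y *ₛ y) ≡ x
x*[y*y]≡x x y = trans (cong (x *ₛ_) (s*s≡+ y)) (*ₛ-identityʳ x)

pairSign : Sign × Sign → Sign
pairSign (s , t) = opposite (s *ₛ t)

pathSign : List (Sign × Sign) → Sign
pathSign []       = Sign.+
pathSign (p ∷ ps) = pairSign p *ₛ pathSign ps

toSign : Bool → Sign
toSign false = Sign.+
toSign true  = Sign.-

toSign-isPlus : ∀ s → toSign (isPlus s) ≡ opposite s
toSign-isPlus Sign.+ = refl
toSign-isPlus Sign.- = refl

toSign-xor : ∀ p q → toSign (p xor q) ≡ toSign p *ₛ toSign q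
toSign-xor false q     = refl
toSign-xor true  false = refl
toSign-xor true  true  = refl

flagsSign : List Bool → Sign
flagsSign []       = Sign.+
flagsSign (b ∷ bs) = toSign b *ₛ flagsSign bs

-1^_ : ℕ → Sign
-1^ ℕ.zero  = Sign.+
-1^ ℕ.suc n = opposite (-1^ n)

-1^-+ : ∀ m n → -1^ (m ℕ.+ n) ≡ -1^ m *ₛ -1^ n
-1^-+ ℕ.zero    n = refl
-1^-+ (ℕ.suc m) n = trans (cong opposite (-1^-+ m n)) (sym (*ₛ-assoc Sign.- (-1^ m) (-1^ n)))

-1^-double : ∀ k → -1^ (2 ℕ.* k) ≡ Sign.+
-1^-double k = begin
  -1^ (k ℕ.+ (k ℕ.+ 0)) ≡⟨ cong (λ n → -1^ (k ℕ.+ n)) (ℕₚ.+-identityʳ k) ⟩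
  -1^ (k ℕ.+ k)         ≡⟨ -1^-+ k k ⟩
  -1^ k *ₛ -1^ k        ≡⟨ s*s≡+ (-1^ k) ⟩
  Sign.+                ∎
  where open ≡-Reasoning

flagsSign-count : ∀ bs → flagsSign bs ≡ -1^ length (filter (λ b → b Bool.≟ true) bs)
flagsSign-count []           = refl
flagsSign-count (false ∷ bs) = flagsSign-count bs
flagsSign-count (true ∷ bs)  = cong opposite (flagsSign-count bs)

innerFlags-sign : ∀ a b ps →
  flagsSign (innerFlags ((a , b) ∷ ps)) ≡ b *ₛ pathSign ps *ₛ lastSnd b ps
innerFlags-sign a b [] = sym (trans (cong (_*ₛ b) (*ₛ-identityʳ b)) (s*s≡+ b))
innerFlags-sign a b ((a′ , b′) ∷ ps) = begin
  toSign (isPlus (b *ₛ a′)) *ₛ flagsSign (innerFlags ((a′ , b′) ∷ ps))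
    ≡⟨ cong₂ _*ₛ_ (toSign-isPlus (b *ₛ a′)) (innerFlags-sign a′ b′ ps) ⟩
  opposite (b *ₛ a′) *ₛ (b′ *ₛ pathSign ps *ₛ lastSnd b′ ps)
    ≡⟨ rearrange Sign.- b a′ b′ (pathSign ps) (lastSnd b′ ps) ⟩
  b *ₛ (opposite (a′ *ₛ b′) *ₛ pathSign ps) *ₛ lastSnd b′ ps ∎
  where
  open ≡-Reasoning
  rearrange : ∀ m b a′ b′ P L →
    (m *ₛ (b *ₛ a′)) *ₛ ((b′ *ₛ P) *ₛ L) ≡ (b *ₛ ((m *ₛ (a′ *ₛ b′)) *ₛ P)) *ₛ L
  rearrange = solve 6 (λ m b a′ b′ P L →
    (m · (b · a′)) · ((b′ · P) · L) ⊜ (b · ((m · (a′ · b′)) · P)) · L) refl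

-- Each incidence sign occurs in exactly two of the factors.
vertexFlags-sign : ∀ ps → flagsSign (vertexFlags ps) ≡ pathSign ps
vertexFlags-sign [] = refl
vertexFlags-sign ((a , b) ∷ ps) = begin
  toSign (isPlus (L *ₛ a)) *ₛ flagsSign (innerFlags ((a , b) ∷ ps))
    ≡⟨ cong₂ _*ₛ_ (toSign-isPlus (L *ₛ a)) (innerFlags-sign a b ps) ⟩
  opposite (L *ₛ a) *ₛ (b *ₛ pathSign ps *ₛ L)
    ≡⟨ rearrange Sign.- L a b (pathSign ps) ⟩
  opposite (a *ₛ b) *ₛ pathSign ps *ₛ (L *ₛ L)
    ≡⟨ x*[y*y]≡x _ L ⟩
  opposite (a *ₛ b) *ₛ pathSign ps ∎
  where
  open ≡-Reasoning
  L = lastSnd b ps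
  rearrange : ∀ m L a b P →
    (m *ₛ (L *ₛ a)) *ₛ ((b *ₛ P) *ₛ L) ≡ ((m *ₛ (a *ₛ b)) *ₛ P) *ₛ (L *ₛ L)
  rearrange = solve 5 (λ m L a b P →
    (m · (L · a)) · ((b · P) · L) ⊜ ((m · (a · b)) · P) · (L · L)) refl

-- Pairs of monomials

infixl 6 _⊞_ _⊕_
infixr 7 _•_

_⊞_ : ∀ {n} → Vec ℕ n → Vec ℕ n → Vec ℕ n
_⊞_ = zipWith ℕ._+_

bump : ∀ {n} → Fin n → Vec ℕ n → Vec ℕ n
bump i α = updateAt α i ℕ.suc

⊞-comm : ∀ {n} (α β : Vec ℕ n) → α ⊞ β ≡ β ⊞ α
⊞-comm = zipWith-comm ℕₚ.+-comm

bump-⊞ : ∀ {n} i (α β : Vec ℕ n) → bump i α ⊞ β ≡ bump i (α ⊞ β)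
bump-⊞ zero    (x ∷ α) (y ∷ β) = refl
bump-⊞ (suc i) (x ∷ α) (y ∷ β) = cong (x ℕ.+ y ∷_) (bump-⊞ i α β)

⊞-bump-swap : ∀ {n} i (α β : Vec ℕ n) → β ⊞ bump i α ≡ α ⊞ bump i β
⊞-bump-swap i α β = begin
  β ⊞ bump i α   ≡⟨ ⊞-comm β (bump i α) ⟩
  bump i α ⊞ β   ≡⟨ bump-⊞ i α β ⟩
  bump i (α ⊞ β) ≡⟨ cong (bump i) (⊞-comm α β) ⟩
  bump i (β ⊞ α) ≡⟨ bump-⊞ i β α ⟨
  bump i β ⊞ α   ≡⟨ ⊞-comm (bump i β) α ⟩
  α ⊞ bump i β   ∎
  where open ≡-Reasoning

MonomialPair : ℕ → Set
MonomialPair n = Vec ℕ n × Vec ℕ n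

0² : ∀ {n} → MonomialPair n
0² = replicate _ 0 , replicate _ 0

_⊕_ : ∀ {n} → MonomialPair n → MonomialPair n → MonomialPair n
(α , β) ⊕ (γ , δ) = α ⊞ γ , β ⊞ δ

⊕-comm : ∀ {n} (U V : MonomialPair n) → U ⊕ V ≡ V ⊕ U
⊕-comm (α , β) (γ , δ) = cong₂ _,_ (⊞-comm α γ) (⊞-comm β δ)

⊕-identityˡ : ∀ {n} (U : MonomialPair n) → 0² ⊕ U ≡ U
⊕-identityˡ (α , β) =
  cong₂ _,_ (zipWith-identityˡ (λ _ → refl) α) (zipWith-identityˡ (λ _ → refl) β)

put : ∀ {n} → Sign → Fin n → MonomialPair n → MonomialPair n
put Sign.+ i (α , β) = bump i α , β
put Sign.- i (α , β) = α , bump i β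

put-⊕ : ∀ {n} s i (U V : MonomialPair n) → put s i (U ⊕ V) ≡ put s i U ⊕ V
put-⊕ Sign.+ i (α , β) (γ , δ) = cong (_, β ⊞ δ) (sym (bump-⊞ i α γ))
put-⊕ Sign.- i (α , β) (γ , δ) = cong (α ⊞ γ ,_) (sym (bump-⊞ i β δ))

_•_ : ∀ {n} → Sign → MonomialPair n → MonomialPair n
Sign.+ • U       = U
Sign.- • (α , β) = β , α

•-put : ∀ {n} s t i (U : MonomialPair n) → s • put t i U ≡ put (s *ₛ t) i (s • U)
•-put Sign.+ t      i U       = refl
•-put Sign.- Sign.+ i (α , β) = refl
•-put Sign.- Sign.- i (α , β) = refl

-- Even and odd parts of a walk

module _ {G : SignedGraph} where
  open SignedGraph G

  no-self-join : ∀ {f a} → ¬ Joins G f a a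
  no-self-join {f} (inj₁ (p , q)) = noLoop f (trans p (sym q))
  no-self-join {f} (inj₂ (p , q)) = noLoop f (trans p (sym q))

  walkSign : ∀ {a b} → Walk G a b → Sign
  walkSign w = pathSign (halfSigns w)

  evenOddMonomials : ∀ {a b} → Sign → Walk G a b → MonomialPair m
  evenOddMonomials c []                   = 0²
  evenOddMonomials c (step {a} {b} f _ w) =
    put (c *ₛ τ f a) f (evenOddMonomials (c *ₛ pairSign (τ f a , τ f b)) w)

  walkSign-++ : ∀ {a b d} (w : Walk G a b) (w′ : Walk G b d) →
    walkSign (w ++ʷ w′) ≡ walkSign w *ₛ walkSign w′
  walkSign-++ []                   w′ = refl
  walkSign-++ (step {a} {b} f _ w) w′ =
    trans (cong (pairSign (τ f a , τ f b) *ₛ_) (walkSign-++ w w′))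
          (sym (*ₛ-assoc (pairSign (τ f a , τ f b)) (walkSign w) (walkSign w′)))

  walkSign-reverse : ∀ {a b} (w : Walk G a b) → walkSign (reverseʷ w) ≡ walkSign w
  walkSign-reverse []                   = refl
  walkSign-reverse (step {a} {b} f j w) = begin
    walkSign (reverseʷ w ++ʷ step f (joins-sym {G = G} j) [])
      ≡⟨ walkSign-++ (reverseʷ w) _ ⟩
    walkSign (reverseʷ w) *ₛ (opposite (τ f b *ₛ τ f a) *ₛ Sign.+)
      ≡⟨ cong₂ _*ₛ_ (walkSign-reverse w)
                    (trans (*ₛ-identityʳ _) (cong opposite (*ₛ-comm (τ f b) (τ f a)))) ⟩
    walkSign w *ₛ opposite (τ f a *ₛ τ f b)
      ≡⟨ *ₛ-comm (walkSign w) _ ⟩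
    opposite (τ f a *ₛ τ f b) *ₛ walkSign w ∎
    where open ≡-Reasoning

  evenOddMonomials-scale : ∀ s c {a b} (w : Walk G a b) →
    evenOddMonomials (s *ₛ c) w ≡ s • evenOddMonomials c w
  evenOddMonomials-scale Sign.+ c w  = refl
  evenOddMonomials-scale Sign.- c [] = refl
  evenOddMonomials-scale s c (step {a} {b} f _ w) = begin
    put (s *ₛ c *ₛ τ f a) f (evenOddMonomials (s *ₛ c *ₛ σ) w)
      ≡⟨ cong₂ (λ t U → put t f U) (*ₛ-assoc s c (τ f a))
               (trans (cong (λ t → evenOddMonomials t w) (*ₛ-assoc s c σ))
                      (evenOddMonomials-scale s (c *ₛ σ) w)) ⟩
    put (s *ₛ (c *ₛ τ f a)) f (s • evenOddMonomials (c *ₛ σ) w)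
      ≡⟨ sym (•-put s (c *ₛ τ f a) f _) ⟩
    s • put (c *ₛ τ f a) f (evenOddMonomials (c *ₛ σ) w) ∎
    where
    open ≡-Reasoning
    σ = pairSign (τ f a , τ f b)

  evenOddMonomials-rescale : ∀ c d {a b} (w : Walk G a b) →
    evenOddMonomials c w ≡ (c *ₛ d) • evenOddMonomials d w
  evenOddMonomials-rescale c d w = begin
    evenOddMonomials c w               ≡⟨ cong (λ t → evenOddMonomials t w) (sym (x*[y*y]≡x c d)) ⟩
    evenOddMonomials (c *ₛ (d *ₛ d)) w ≡⟨ cong (λ t → evenOddMonomials t w) (sym (*ₛ-assoc c d d)) ⟩
    evenOddMonomials (c *ₛ d *ₛ d) w   ≡⟨ evenOddMonomials-scale (c *ₛ d) d w ⟩
    (c *ₛ d) • evenOddMonomials d w    ∎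
    where open ≡-Reasoning

  evenOddMonomials-++ : ∀ c {a b d} (w : Walk G a b) (w′ : Walk G b d) →
    evenOddMonomials c (w ++ʷ w′)
      ≡ evenOddMonomials c w ⊕ evenOddMonomials (c *ₛ walkSign w) w′
  evenOddMonomials-++ c [] w′ =
    sym (trans (⊕-identityˡ _) (cong (λ t → evenOddMonomials t w′) (*ₛ-identityʳ c)))
  evenOddMonomials-++ c (step {a} {b} f j w) w′ = begin
    put (c *ₛ τ f a) f (evenOddMonomials (c *ₛ σ) (w ++ʷ w′))
      ≡⟨ cong (put (c *ₛ τ f a) f) (evenOddMonomials-++ (c *ₛ σ) w w′) ⟩
    put (c *ₛ τ f a) f (evenOddMonomials (c *ₛ σ) w ⊕ evenOddMonomials (c *ₛ σ *ₛ walkSign w) w′)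
      ≡⟨ put-⊕ (c *ₛ τ f a) f _ _ ⟩
    evenOddMonomials c (step f j w) ⊕ evenOddMonomials (c *ₛ σ *ₛ walkSign w) w′
      ≡⟨ cong (λ t → evenOddMonomials c (step f j w) ⊕ evenOddMonomials t w′)
              (*ₛ-assoc c σ (walkSign w)) ⟩
    evenOddMonomials c (step f j w) ⊕ evenOddMonomials (c *ₛ (σ *ₛ walkSign w)) w′ ∎
    where
    open ≡-Reasoning
    σ = pairSign (τ f a , τ f b)

  evenOddMonomials-reverse : ∀ c {a b} (w : Walk G a b) →
    evenOddMonomials c (reverseʷ w) ≡ evenOddMonomials (opposite (c *ₛ walkSign w)) w
  evenOddMonomials-reverse c [] = refl
  evenOddMonomials-reverse c (step {a} {b} f j w) = begin
    evenOddMonomials c (reverseʷ w ++ʷ step f (joins-sym {G = G} j) [])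
      ≡⟨ evenOddMonomials-++ c (reverseʷ w) _ ⟩
    evenOddMonomials c (reverseʷ w) ⊕ put (c *ₛ walkSign (reverseʷ w) *ₛ τ f b) f 0²
      ≡⟨ cong₂ (λ U t → U ⊕ put (c *ₛ t *ₛ τ f b) f 0²)
               (evenOddMonomials-reverse c w) (walkSign-reverse w) ⟩
    evenOddMonomials (opposite (c *ₛ Π)) w ⊕ put (c *ₛ Π *ₛ τ f b) f 0²
      ≡⟨ ⊕-comm _ _ ⟩
    put (c *ₛ Π *ₛ τ f b) f 0² ⊕ evenOddMonomials (opposite (c *ₛ Π)) w
      ≡⟨ sym (put-⊕ _ f 0² _) ⟩
    put (c *ₛ Π *ₛ τ f b) f (0² ⊕ evenOddMonomials (opposite (c *ₛ Π)) w)
      ≡⟨ cong₂ (λ t U → put t f U) first-label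
               (trans (⊕-identityˡ _) (cong (λ t → evenOddMonomials t w) rest-label)) ⟩
    put (c′ *ₛ τ f a) f (evenOddMonomials (c′ *ₛ σ) w) ∎
    where
    open ≡-Reasoning
    Π  = walkSign w
    σ  = pairSign (τ f a , τ f b)
    c′ = opposite (c *ₛ (σ *ₛ Π))
    first-label : c *ₛ Π *ₛ τ f b ≡ c′ *ₛ τ f a
    first-label = sym (trans (rearrange Sign.- c (τ f a) (τ f b) Π) (x*[y*y]≡x _ (τ f a)))
      where
      rearrange : ∀ m c a b Π →
        (m *ₛ (c *ₛ ((m *ₛ (a *ₛ b)) *ₛ Π))) *ₛ a ≡ ((c *ₛ Π) *ₛ b) *ₛ ((m *ₛ m) *ₛ (a *ₛ a))
      rearrange = solve 5 (λ m c a b Π →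
        (m · (c · ((m · (a · b)) · Π))) · a ⊜ ((c · Π) · b) · ((m · m) · (a · a))) refl
    rest-label : opposite (c *ₛ Π) ≡ c′ *ₛ σ
    rest-label = sym (trans (rearrange Sign.- c σ Π) (x*[y*y]≡x _ σ))
      where
      rearrange : ∀ m c σ Π → (m *ₛ (c *ₛ (σ *ₛ Π))) *ₛ σ ≡ (m *ₛ (c *ₛ Π)) *ₛ (σ *ₛ σ)
      rearrange = solve 4 (λ m c σ Π → (m · (c · (σ · Π))) · σ ⊜ (m · (c · Π)) · (σ · σ)) refl

  evenOddMonomials-++-reverse : ∀ c {a b} (w₁ w₂ : Walk G a b) → walkSign w₁ ≡ walkSign w₂ →
    evenOddMonomials c (w₁ ++ʷ reverseʷ w₂)
      ≡ evenOddMonomials c w₁ ⊕ evenOddMonomials (opposite c) w₂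
  evenOddMonomials-++-reverse c w₁ w₂ same = begin
    evenOddMonomials c (w₁ ++ʷ reverseʷ w₂)
      ≡⟨ evenOddMonomials-++ c w₁ (reverseʷ w₂) ⟩
    evenOddMonomials c w₁ ⊕ evenOddMonomials (c *ₛ walkSign w₁) (reverseʷ w₂)
      ≡⟨ cong (evenOddMonomials c w₁ ⊕_) (evenOddMonomials-reverse _ w₂) ⟩
    evenOddMonomials c w₁ ⊕ evenOddMonomials (opposite (c *ₛ walkSign w₁ *ₛ walkSign w₂)) w₂
      ≡⟨ cong (λ t → evenOddMonomials c w₁ ⊕ evenOddMonomials (opposite t) w₂) cancel ⟩
    evenOddMonomials c w₁ ⊕ evenOddMonomials (opposite c) w₂ ∎
    where
    open ≡-Reasoning
    cancel : c *ₛ walkSign w₁ *ₛ walkSign w₂ ≡ c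
    cancel = trans (cong (λ t → c *ₛ t *ₛ walkSign w₂) same)
                   (trans (*ₛ-assoc c _ _) (x*[y*y]≡x c (walkSign w₂)))

  walkSign-even : ∀ {a} (w : Walk G a a) → EvenWalk w → walkSign w ≡ Sign.+
  walkSign-even w (k , even) = begin
    pathSign (halfSigns w)        ≡⟨ vertexFlags-sign (halfSigns w) ⟨
    flagsSign (unbalancedFlags w) ≡⟨ flagsSign-count (unbalancedFlags w) ⟩
    -1^ numUnbalanced w           ≡⟨ cong -1^_ even ⟩
    -1^ (2 ℕ.* k)                 ≡⟨ -1^-double k ⟩
    Sign.+                        ∎
    where open ≡-Reasoning

  walkSign-closing : ∀ {u v e} (j : Joins G e u v) (w₁ w₂ : Walk G v u) →
    EvenWalk (e ⟨ j ⟩∷ w₁) → EvenWalk (e ⟨ j ⟩∷ w₂) → walkSign w₁ ≡ walkSign w₂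
  walkSign-closing {u} {v} {e} j w₁ w₂ even₁ even₂ =
    *ₛ-cancelˡ-≡ (pairSign (τ e u , τ e v)) _ _
      (trans (walkSign-even (e ⟨ j ⟩∷ w₁) even₁) (sym (walkSign-even (e ⟨ j ⟩∷ w₂) even₂)))

-- Binomials

module _ {ℓ₁ ℓ₂} (K : Field ℓ₁ ℓ₂) {m : ℕ} where
  open Field K renaming (sym to ≈-sym; trans to ≈-trans; reflexive to ≈-reflexive)
  open Poly K m
  open import Algebra.Properties.Ring ring using (-1*x≈-x; -‿distribˡ-*; -‿distribʳ-*)
  open import Algebra.Properties.AbelianGroup +-abelianGroup using (⁻¹-anti-homo‿-; xyx⁻¹≈y)
  open import Relation.Binary.Reasoning.Setoid setoid

  binomialOf : MonomialPair m → Polynomial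
  binomialOf (α , β) = (1# , α) ∷ (- 1# , β) ∷ []

  ⟦_⟧ : Sign → Carrier
  ⟦ Sign.+ ⟧ = 1#
  ⟦ Sign.- ⟧ = - 1#

  [z-y]+[x-z]≈x-y : ∀ x y z → (z - y) + (x - z) ≈ x - y
  [z-y]+[x-z]≈x-y x y z = begin
    (z - y) + (x - z)   ≈⟨ +-assoc z (- y) (x - z) ⟩
    z + (- y + (x - z)) ≈⟨ +-congˡ (+-assoc (- y) x (- z)) ⟨
    z + (- y + x - z)   ≈⟨ +-assoc z (- y + x) (- z) ⟨
    z + (- y + x) - z   ≈⟨ xyx⁻¹≈y z (- y + x) ⟩
    - y + x             ≈⟨ +-comm (- y) x ⟩
    x - y               ∎

  a[z-y]+[-a][z-x]≈a[x-y] : ∀ a x y z → a * (z - y) + - a * (z - x) ≈ a * (x - y)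
  a[z-y]+[-a][z-x]≈a[x-y] a x y z = begin
    a * (z - y) + - a * (z - x)   ≈⟨ +-congˡ (-‿distribˡ-* a (z - x)) ⟨
    a * (z - y) + - (a * (z - x)) ≈⟨ +-congˡ (-‿distribʳ-* a (z - x)) ⟩
    a * (z - y) + a * - (z - x)   ≈⟨ +-congˡ (*-congˡ (⁻¹-anti-homo‿- z x)) ⟩
    a * (z - y) + a * (x - z)     ≈⟨ distribˡ a (z - y) (x - z) ⟨
    a * ((z - y) + (x - z))       ≈⟨ *-congˡ ([z-y]+[x-z]≈x-y x y z) ⟩
    a * (x - y)                   ∎

  kronecker : Monomial → Monomial → Carrier
  kronecker α μ with ≡-dec _≟ℕ_ α μ
  ... | yes _ = 1#
  ... | no  _ = 0#

  coeff-∷ : ∀ a α p μ → coeff ((a , α) ∷ p) μ ≈ a * kronecker α μ + coeff p μ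
  coeff-∷ a α p μ with ≡-dec _≟ℕ_ α μ
  ... | yes _ = +-congʳ (≈-sym (*-identityʳ a))
  ... | no  _ = ≈-sym (≈-trans (+-congʳ (zeroʳ a)) (+-identityˡ _))

  coeff-++ : ∀ p q μ → coeff (p ++ q) μ ≈ coeff p μ + coeff q μ
  coeff-++ [] q μ = ≈-sym (+-identityˡ _)
  coeff-++ ((a , α) ∷ p) q μ = begin
    coeff ((a , α) ∷ p ++ q) μ                  ≈⟨ coeff-∷ a α (p ++ q) μ ⟩
    a * kronecker α μ + coeff (p ++ q) μ        ≈⟨ +-congˡ (coeff-++ p q μ) ⟩
    a * kronecker α μ + (coeff p μ + coeff q μ) ≈⟨ +-assoc _ _ _ ⟨
    a * kronecker α μ + coeff p μ + coeff q μ   ≈⟨ +-congʳ (coeff-∷ a α p μ) ⟨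
    coeff ((a , α) ∷ p) μ + coeff q μ           ∎

  coeff-pair : ∀ a α b β μ →
    coeff ((a , α) ∷ (b , β) ∷ []) μ ≈ a * kronecker α μ + b * kronecker β μ
  coeff-pair a α b β μ =
    ≈-trans (coeff-∷ a α _ μ) (+-congˡ (≈-trans (coeff-∷ b β [] μ) (+-identityʳ _)))

  coeff-binomialOf : ∀ t α β μ →
    coeff (binomialOf (t • (α , β))) μ ≈ ⟦ t ⟧ * (kronecker α μ - kronecker β μ)
  coeff-binomialOf Sign.+ α β μ = begin
    coeff (binomialOf (α , β)) μ ≈⟨ coeff-pair 1# α (- 1#) β μ ⟩
    1# * x + - 1# * y            ≈⟨ +-cong (*-identityˡ x) (-1*x≈-x y) ⟩
    x - y                        ≈⟨ *-identityˡ (x - y) ⟨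
    1# * (x - y)                 ∎
    where
    x = kronecker α μ
    y = kronecker β μ
  coeff-binomialOf Sign.- α β μ = begin
    coeff (binomialOf (β , α)) μ ≈⟨ coeff-pair 1# β (- 1#) α μ ⟩
    1# * y + - 1# * x            ≈⟨ +-cong (*-identityˡ y) (-1*x≈-x x) ⟩
    y - x                        ≈⟨ ⁻¹-anti-homo‿- x y ⟨
    - (x - y)                    ≈⟨ -1*x≈-x (x - y) ⟨
    - 1# * (x - y)               ∎
    where
    x = kronecker α μ
    y = kronecker β μ

  coeff-monomial*binomialOf : ∀ a γ α β μ →
    coeff (((a , γ) ∷ []) *ₚ binomialOf (α , β)) μ
      ≈ a * (kronecker (γ ⊞ α) μ - kronecker (γ ⊞ β) μ)
  coeff-monomial*binomialOf a γ α β μ = begin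
    coeff ((a * 1# , γ ⊞ α) ∷ (a * - 1# , γ ⊞ β) ∷ []) μ
      ≈⟨ coeff-pair _ (γ ⊞ α) _ (γ ⊞ β) μ ⟩
    a * 1# * x + a * - 1# * y
      ≈⟨ +-cong (*-congʳ (*-identityʳ a)) (≈-trans (*-assoc a (- 1#) y) (*-congˡ (-1*x≈-x y))) ⟩
    a * x + a * - y
      ≈⟨ distribˡ a x (- y) ⟨
    a * (x - y) ∎
    where
    x = kronecker (γ ⊞ α) μ
    y = kronecker (γ ⊞ β) μ

  -- ±(x^(α+δ) − x^(β+γ)) = ±x^β (x^κ₁ − x^γ) ∓ x^α (x^κ₂ − x^δ), the terms x^(β+κ₁) cancelling.
  binomial-syzygy : ∀ t {α β κ₁ κ₂} γ δ → β ⊞ κ₁ ≡ α ⊞ κ₂ →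
    InIdeal₂ (binomialOf (t • (α ⊞ δ , β ⊞ γ))) (binomialOf (κ₁ , γ)) (binomialOf (κ₂ , δ))
  binomial-syzygy t {α} {β} {κ₁} {κ₂} γ δ cross = f , g , λ μ → begin
    coeff (binomialOf (t • (α ⊞ δ , β ⊞ γ))) μ
      ≈⟨ coeff-binomialOf t (α ⊞ δ) (β ⊞ γ) μ ⟩
    ⟦ t ⟧ * (kronecker (α ⊞ δ) μ - kronecker (β ⊞ γ) μ)
      ≈⟨ a[z-y]+[-a][z-x]≈a[x-y] ⟦ t ⟧ _ _ _ ⟨
    ⟦ t ⟧ * (kronecker (β ⊞ κ₁) μ - kronecker (β ⊞ γ) μ)
      + - ⟦ t ⟧ * (kronecker (β ⊞ κ₁) μ - kronecker (α ⊞ δ) μ)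
      ≈⟨ +-congˡ (*-congˡ (+-congʳ (≈-reflexive (cong (λ ζ → kronecker ζ μ) cross)))) ⟩
    ⟦ t ⟧ * (kronecker (β ⊞ κ₁) μ - kronecker (β ⊞ γ) μ)
      + - ⟦ t ⟧ * (kronecker (α ⊞ κ₂) μ - kronecker (α ⊞ δ) μ)
      ≈⟨ +-cong (coeff-monomial*binomialOf ⟦ t ⟧ β κ₁ γ μ)
                (coeff-monomial*binomialOf (- ⟦ t ⟧) α κ₂ δ μ) ⟨
    coeff (f *ₚ binomialOf (κ₁ , γ)) μ + coeff (g *ₚ binomialOf (κ₂ , δ)) μ
      ≈⟨ coeff-++ (f *ₚ binomialOf (κ₁ , γ)) _ μ ⟨
    coeff (f *ₚ binomialOf (κ₁ , γ) +ₚ g *ₚ binomialOf (κ₂ , δ)) μ ∎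
    where
    f = (⟦ t ⟧ , β) ∷ []
    g = (- ⟦ t ⟧ , α) ∷ []

  binomialOf-put-syzygy : ∀ t i (U W : MonomialPair m) →
    InIdeal₂ (binomialOf (t • U ⊕ opposite t • W))
             (binomialOf (put Sign.+ i U)) (binomialOf (put Sign.+ i W))
  binomialOf-put-syzygy t i (α , γ) (β , δ) =
    subst (λ V → InIdeal₂ (binomialOf V) _ _) (sym (shape t))
          (binomial-syzygy t γ δ (⊞-bump-swap i α β))
    where
    shape : ∀ t → t • (α , γ) ⊕ opposite t • (β , δ) ≡ t • (α ⊞ δ , β ⊞ γ)
    shape Sign.+ = cong (α ⊞ δ ,_) (⊞-comm γ β)
    shape Sign.- = cong (_, α ⊞ δ) (⊞-comm γ β)

-- The binomial B of a closed walk

module _ {ℓ₁ ℓ₂} (K : Field ℓ₁ ℓ₂) {G : SignedGraph} where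
  open SignedGraph G
  open Poly K m using (monomialOf)

  monomials : List (Fin m) × List (Fin m) → MonomialPair m
  monomials = Product.map monomialOf monomialOf

  monomials-place : ∀ p i ps → monomials (place p i ps) ≡ put (toSign p) i (monomials ps)
  monomials-place false i ps = refl
  monomials-place true  i ps = refl

  splitParity-evenOdd : ∀ p c {a b d} f (j : Joins G f a b) (w : Walk G b d) →
    c *ₛ τ f a ≡ toSign p →
    monomials (splitParity p (edges (step f j w)) (innerFlags (halfSigns (step f j w))))
      ≡ evenOddMonomials c (step f j w)
  splitParity-evenOdd p c f j [] label =
    trans (monomials-place p f _) (cong (λ s → put s f 0²) (sym label))
  splitParity-evenOdd p c {a} {b} f j (step g k w) label =
    trans (monomials-place p f _)
          (cong₂ (λ s U → put s f U) (sym label) (splitParity-evenOdd p′ (c *ₛ σ) g k w next-label))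
    where
    open ≡-Reasoning
    σ  = pairSign (τ f a , τ f b)
    p′ = p xor isPlus (τ f b *ₛ τ g b)
    next-label : c *ₛ σ *ₛ τ g b ≡ toSign p′
    next-label = begin
      c *ₛ σ *ₛ τ g b                                ≡⟨ rearrange Sign.- c (τ f a) (τ f b) (τ g b) ⟩
      c *ₛ τ f a *ₛ opposite (τ f b *ₛ τ g b)        ≡⟨ cong₂ _*ₛ_ label (sym (toSign-isPlus _)) ⟩
      toSign p *ₛ toSign (isPlus (τ f b *ₛ τ g b))  ≡⟨ toSign-xor p _ ⟨
      toSign p′                                      ∎
      where
      rearrange : ∀ m c a b a′ → c *ₛ (m *ₛ (a *ₛ b)) *ₛ a′ ≡ c *ₛ a *ₛ (m *ₛ (b *ₛ a′))
      rearrange = solve 5 (λ m c a b a′ →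
        (c · (m · (a · b))) · a′ ⊜ (c · a) · (m · (b · a′))) refl

  B-evenOdd : ∀ {a b} f (j : Joins G f a b) (w : Walk G b a) →
    B K (step f j w) ≡ binomialOf K (evenOddMonomials (τ f a) (step f j w))
  B-evenOdd {a} f j w =
    cong (binomialOf K) (splitParity-evenOdd false (τ f a) f j w (s*s≡+ (τ f a)))

  B-closing : ∀ {u v} e (j : Joins G e u v) (w : Walk G v u) →
    B K (e ⟨ j ⟩∷ w)
      ≡ binomialOf K (put Sign.+ e (evenOddMonomials (τ e u *ₛ pairSign (τ e u , τ e v)) w))
  B-closing {u} {v} e j w =
    trans (B-evenOdd e j w) (cong (λ s → binomialOf K (put s e U)) (s*s≡+ (τ e u)))
    where U = evenOddMonomials (τ e u *ₛ pairSign (τ e u , τ e v)) w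

  B-++-reverse : ∀ {v y u} f (j : Joins G f v y) (r : Walk G y u) (w : Walk G v u) d →
    walkSign (step f j r) ≡ walkSign w →
    B K (step f j r ++ʷ reverseʷ w)
      ≡ binomialOf K ((τ f v *ₛ d) • evenOddMonomials d (step f j r)
                      ⊕ opposite (τ f v *ₛ d) • evenOddMonomials d w)
  B-++-reverse {v} f j r w d same = begin
    B K (step f j r ++ʷ reverseʷ w)
      ≡⟨ B-evenOdd f j (r ++ʷ reverseʷ w) ⟩
    binomialOf K (evenOddMonomials c (step f j r ++ʷ reverseʷ w))
      ≡⟨ cong (binomialOf K) (evenOddMonomials-++-reverse c (step f j r) w same) ⟩
    binomialOf K (evenOddMonomials c (step f j r) ⊕ evenOddMonomials (opposite c) w)
      ≡⟨ cong₂ (λ V V′ → binomialOf K (V ⊕ V′))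
               (evenOddMonomials-rescale c d (step f j r))
               (evenOddMonomials-rescale (opposite c) d w) ⟩
    binomialOf K ((c *ₛ d) • U ⊕ (opposite c *ₛ d) • W)
      ≡⟨ cong (λ s → binomialOf K ((c *ₛ d) • U ⊕ s • W)) (*ₛ-assoc Sign.- c d) ⟩
    binomialOf K ((c *ₛ d) • U ⊕ opposite (c *ₛ d) • W) ∎
    where
    open ≡-Reasoning
    c = τ f v
    U = evenOddMonomials d (step f j r)
    W = evenOddMonomials d w

corollary4p5 : ∀ {c ℓ} (K : Field c ℓ) (G : SignedGraph)
    {u v : Fin (SignedGraph.n G)} (e : Fin (SignedGraph.m G)) (j : Joins G e u v)
    (w₁′ w₂′ : Walk G v u) →
    EvenWalk (e ⟨ j ⟩∷ w₁′) → EvenWalk (e ⟨ j ⟩∷ w₂′) →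
    Poly.InIdeal₂ K (SignedGraph.m G)
    (B K (w₁′ ++ʷ reverseʷ w₂′))
    (B K (e ⟨ j ⟩∷ w₁′))
    (B K (e ⟨ j ⟩∷ w₂′))
corollary4p5 K G e j [] w₂′ _ _ = ⊥-elim (no-self-join {G = G} j)
corollary4p5 K G {u} {v} e j w₁′@(step f j₁ r) w₂′ even₁ even₂
  rewrite B-closing K {G = G} e j w₁′ | B-closing K {G = G} e j w₂′ =
  subst (λ p → Poly.InIdeal₂ K m p (binomialOf K (put Sign.+ e U))
                                   (binomialOf K (put Sign.+ e W)))
        (sym (B-++-reverse K f j₁ r w₂′ d (walkSign-closing j w₁′ w₂′ even₁ even₂)))
        (binomialOf-put-syzygy K (τ f v *ₛ d) e U W)
  where
  open SignedGraph G
  d = τ e u *ₛ pairSign (τ e u , τ e v)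
  U = evenOddMonomials d w₁′
  W = evenOddMonomials d w₂′
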